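{- Let $G=(V,E)$ be a directed unweighted graph with $(s,t)$-max-flow value $\lambda$, and let $\mathcal{A}$ be a family of $\lambda+1$ integral $(s,t)$-max-flows of $G$ such that each non-critical edge carries zero flow in some member of $\mathcal{A}$. Let $e_1,e_2\in E$ and let $f\in\mathcal{A}$ satisfy $f(e_1)=0$ and $f(e_2)=1$. Then $\textsc{max-flow}(s,t,G-\{e_1,e_2\})=\lambda-1$ if and only if the endpoints of $e_2$ are not strongly connected in $G_f-e_1$.
   Context: Edges have unit capacity (multigraphs allowed). An edge is critical if it lies in some $(s,t)$-min-cut. For a $0/1$ flow $f$, the residual graph $G_f$ has vertex set $V$, contains each edge $e$ with $f(e)=0$ with its original direction and contains the reverse of each edge $e$ with $f(e)=1$. $G_f-e_1$ denotes $G_f$ with (the copy of) $e_1$ removed. $\textsc{max-flow}(s,t,\cdot)$ is the $(s,t)$-max-flow value. -}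

module Defs where

open import Data.Nat using (ℕ; zero; suc; _+_; _≤_)
open import Data.Bool using (Bool; true; false; if_then_else_; _∧_; _∨_; not)
open import Data.Fin using (Fin; zero; suc; _≟_)
open import Data.List using (List; []; _∷_; length; lookup)
open import Data.List.Membership.Propositional using (_∈_)
open import Data.Product using (_×_; _,_; proj₁; proj₂; Σ; ∃)
open import Relation.Nullary using (¬_; does)
open import Relation.Binary.PropositionalEquality using (_≡_; _≢_)

-- A directed multigraph on vertex set Fin n is a list of edges (tail , head);
-- edges are identified by their position in the list (unit capacities).
Graph : ℕ → Set
Graph n = List (Fin n × Fin n)

Edge : ∀ {n} → Graph n → Set
Edge G = Fin (length G)

tl hd : ∀ {n} (G : Graph n) → Edge G → Fin n
tl G e = proj₁ (lookup G e)
hd G e = proj₂ (lookup G e)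

count : ∀ {k} → (Fin k → Bool) → ℕ
count {zero} p = 0
count {suc k} p = (if p zero then 1 else 0) + count (λ i → p (suc i))

_==_ : ∀ {n} → Fin n → Fin n → Bool
a == b = does (a ≟ b)

-- 0/1 edge function (integral flow under unit capacities; capacity constraint automatic)
Flow01 : ∀ {n} → Graph n → Set
Flow01 G = Edge G → Bool

inflow outflow : ∀ {n} (G : Graph n) → Flow01 G → Fin n → ℕ
inflow G f v = count (λ e → f e ∧ (hd G e == v))
outflow G f v = count (λ e → f e ∧ (tl G e == v))

IsFlow : ∀ {n} (G : Graph n) (s t : Fin n) → Flow01 G → ℕ → Set
IsFlow G s t f k =
  (∀ v → v ≢ s → v ≢ t → inflow G f v ≡ outflow G f v)
  × outflow G f s ≡ inflow G f s + k

IsMaxFlowValue : ∀ {n} (G : Graph n) (s t : Fin n) → ℕ → Set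
IsMaxFlowValue G s t k =
  (Σ (Flow01 G) λ f → IsFlow G s t f k)
  × (∀ (f : Flow01 G) (j : ℕ) → IsFlow G s t f j → j ≤ k)

VSet : ℕ → Set
VSet n = Fin n → Bool

IsCut : ∀ {n} (s t : Fin n) → VSet n → Set
IsCut s t S = (S s ≡ true) × (S t ≡ false)

InCut : ∀ {n} (G : Graph n) → VSet n → Edge G → Bool
InCut G S e = S (tl G e) ∧ not (S (hd G e))

cutCap : ∀ {n} (G : Graph n) → VSet n → ℕ
cutCap G S = count (InCut G S)

IsMinCut : ∀ {n} (G : Graph n) (s t : Fin n) → VSet n → Set
IsMinCut G s t S = IsCut s t S × (∀ S' → IsCut s t S' → cutCap G S ≤ cutCap G S')

Critical : ∀ {n} (G : Graph n) (s t : Fin n) → Edge G → Set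
Critical G s t e = ∃ λ S → IsMinCut G s t S × (InCut G S e ≡ true)

-- residual graph G_f with the (copies of) edges marked by d removed:
-- same edge indices as G; edges with f(e)=1 reversed, edges with f(e)=0 kept
residualMinus : ∀ {n} (G : Graph n) → Flow01 G → (Edge G → Bool) → Graph n
residualMinus [] f d = []
residualMinus ((u , v) ∷ G) f d =
  if d zero then rest
  else (if f zero then (v , u) else (u , v)) ∷ rest
  where
  rest = residualMinus G (λ i → f (suc i)) (λ i → d (suc i))

residual : ∀ {n} (G : Graph n) → Flow01 G → Graph n
residual G f = residualMinus G f (λ _ → false)

deleteEdges : ∀ {n} (G : Graph n) → (Edge G → Bool) → Graph n
deleteEdges [] d = []
deleteEdges (x ∷ G) d =
  if d zero then deleteEdges G (λ i → d (suc i))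
  else x ∷ deleteEdges G (λ i → d (suc i))

data Reach {n} (G : Graph n) : Fin n → Fin n → Set where
  here : ∀ {u} → Reach G u u
  step : ∀ {u w v} → (u , w) ∈ G → Reach G w v → Reach G u v

StronglyConnected : ∀ {n} (G : Graph n) → Fin n → Fin n → Set
StronglyConnected G u v = Reach G u v × Reach G v u

-- Write f = A j, R = G_f − e₁ and u → v for e₂. Since f(e₂) = 1, R contains the reversed
-- copy v → u of e₂, so u and v are strongly connected in R iff v is reachable from u.
-- Every (s,t)-cut has capacity at least λ in G − e₁, since f avoids e₁, and loses at most
-- the edge e₂ in H = G − {e₁, e₂}.
-- If v is unreachable, the set of vertices reachable from u is closed in R: f leaves it
-- through e₂ and never enters it, so it is an (s,t)-cut of capacity λ in G − e₁ crossed by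
-- e₂, hence of capacity λ − 1 in H, and max-flow min-cut in H gives the value λ − 1.
-- Conversely, a minimum cut of H of capacity λ − 1 has capacity at most λ in G − e₁, so f
-- saturates it and sends nothing back: it is closed in R and must be crossed by e₂, which
-- puts u inside and v outside, so v is unreachable from u.
-- Max-flow min-cut itself is proved by Ford–Fulkerson augmentation along simple residual paths.

module Submission where

open import Defs
open import Data.Bool using (Bool; true; false; if_then_else_; _∧_; _∨_; not)
open import Data.Bool.Properties
  using (∧-identityʳ; ∧-zeroʳ; ∧-comm; ∧-conicalˡ; ∧-conicalʳ; ∨-zeroʳ; ∨-identityʳ; not-injective)
open import Data.Empty using (⊥-elim)
open import Data.Fin using (Fin; zero; suc; _≟_; punchIn)
open import Data.Fin.Properties using (punchInᵢ≢i)
open import Data.List using (length; []; _∷_)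
open import Data.List.Membership.Propositional using (_∈_)
open import Data.List.Relation.Unary.Any using (here; there)
open import Data.Nat using (ℕ; zero; suc; _+_; _≤_; _<_; z≤n; s≤s)
open import Data.Nat.Properties hiding (_≟_)
open import Algebra.Properties.CommutativeMonoid.Sum +-0-commutativeMonoid
  using (sum-syntax; ∑-comm; ∑-distrib-+; sum-remove; sum-cong-≗; sum-replicate-zero)
open import Data.Nat.Solver using (module +-*-Solver)
open import Data.Product using (_×_; _,_; proj₁; proj₂; Σ; ∃)
open import Data.Sum using (_⊎_; inj₁; inj₂)
open import Data.Unit using (⊤; tt)
open import Function.Bundles using (_⇔_; mk⇔)
open import Relation.Binary.PropositionalEquality
open import Relation.Nullary using (¬_; yes; no; Dec; _⊎-dec_)
open import Relation.Nullary.Decidable using (dec-true; dec-false)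
open +-*-Solver using (solve; _:+_; _:=_)

⟦_⟧ : Bool → ℕ
⟦ b ⟧ = if b then 1 else 0

==⇒≡ : ∀ {n} {a b : Fin n} → (a == b) ≡ true → a ≡ b
==⇒≡ {a = a} {b} eq with a ≟ b | eq
... | yes a≡b | _ = a≡b

==-refl : ∀ {n} (a : Fin n) → (a == a) ≡ true
==-refl a = dec-true (a ≟ a) refl

≢⇒==-false : ∀ {n} {a b : Fin n} → a ≢ b → (a == b) ≡ false
≢⇒==-false {a = a} {b} = dec-false (a ≟ b)

true≢false : true ≢ false
true≢false ()

==-false⇒≢ : ∀ {n} {a b : Fin n} → (a == b) ≡ false → a ≢ b
==-false⇒≢ {a = a} {b} eq a≡b with () ← trans (sym eq) (dec-true (a ≟ b) a≡b)

-- Finite sums and counting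

∑-cong-except : ∀ {n} (F G : Fin n → ℕ) (c : Fin n) → (∀ z → z ≢ c → F z ≡ G z) →
  ∑[ z < n ] F z + G c ≡ ∑[ z < n ] G z + F c
∑-cong-except {suc n} F G c agree = begin
  ∑[ z < suc n ] F z + G c
    ≡⟨ cong (_+ G c) (sum-remove {i = c} F) ⟩
  F c + ∑[ z < n ] F (punchIn c z) + G c
    ≡⟨ solve 3 (λ x y w → x :+ y :+ w := w :+ y :+ x) refl (F c) _ (G c) ⟩
  G c + ∑[ z < n ] F (punchIn c z) + F c
    ≡⟨ cong (λ r → G c + r + F c) (sum-cong-≗ (λ z → agree _ (punchInᵢ≢i c z))) ⟩
  G c + ∑[ z < n ] G (punchIn c z) + F c
    ≡⟨ cong (_+ F c) (sym (sum-remove {i = c} G)) ⟩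
  ∑[ z < suc n ] G z + F c ∎
  where open ≡-Reasoning

∑-point : ∀ {n} (F : Fin n → ℕ) (c : Fin n) → (∀ z → z ≢ c → F z ≡ 0) → ∑[ z < n ] F z ≡ F c
∑-point {n} F c vanish = begin
  ∑[ z < n ] F z          ≡⟨ sym (+-identityʳ _) ⟩
  ∑[ z < n ] F z + 0      ≡⟨ ∑-cong-except F (λ _ → 0) c vanish ⟩
  ∑[ z < n ] 0 + F c      ≡⟨ cong (_+ F c) (sum-replicate-zero n) ⟩
  F c                     ∎
  where open ≡-Reasoning

count≡∑ : ∀ {k} (p : Fin k → Bool) → count p ≡ ∑[ i < k ] ⟦ p i ⟧
count≡∑ {zero} p = refl
count≡∑ {suc k} p = cong (⟦ p zero ⟧ +_) (count≡∑ (λ i → p (suc i)))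

count-cong : ∀ {k} {p q : Fin k → Bool} → (∀ i → p i ≡ q i) → count p ≡ count q
count-cong {p = p} {q} p≗q = begin
  count p               ≡⟨ count≡∑ p ⟩
  ∑[ i < _ ] ⟦ p i ⟧    ≡⟨ sum-cong-≗ (λ i → cong ⟦_⟧ (p≗q i)) ⟩
  ∑[ i < _ ] ⟦ q i ⟧    ≡⟨ sym (count≡∑ q) ⟩
  count q               ∎
  where open ≡-Reasoning

count-cong-except : ∀ {k} (p q : Fin k → Bool) (j : Fin k) → (∀ i → i ≢ j → p i ≡ q i) →
  count p + ⟦ q j ⟧ ≡ count q + ⟦ p j ⟧
count-cong-except p q j agree = begin
  count p + ⟦ q j ⟧                ≡⟨ cong (_+ ⟦ q j ⟧) (count≡∑ p) ⟩
  ∑[ i < _ ] ⟦ p i ⟧ + ⟦ q j ⟧     ≡⟨ ∑-cong-except _ _ j (λ i i≢j → cong ⟦_⟧ (agree i i≢j)) ⟩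
  ∑[ i < _ ] ⟦ q i ⟧ + ⟦ p j ⟧     ≡⟨ cong (_+ ⟦ p j ⟧) (sym (count≡∑ q)) ⟩
  count q + ⟦ p j ⟧                ∎
  where open ≡-Reasoning

count-pointwise : ∀ {k} (p q r w : Fin k → Bool) →
  (∀ i → ⟦ p i ⟧ + ⟦ q i ⟧ ≡ ⟦ r i ⟧ + ⟦ w i ⟧) → count p + count q ≡ count r + count w
count-pointwise p q r w pointwise = begin
  count p + count q                              ≡⟨ cong₂ _+_ (count≡∑ p) (count≡∑ q) ⟩
  ∑[ i < _ ] ⟦ p i ⟧ + ∑[ i < _ ] ⟦ q i ⟧        ≡⟨ sym (∑-distrib-+ (λ i → ⟦ p i ⟧) (λ i → ⟦ q i ⟧)) ⟩
  ∑[ i < _ ] (⟦ p i ⟧ + ⟦ q i ⟧)                 ≡⟨ sum-cong-≗ pointwise ⟩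
  ∑[ i < _ ] (⟦ r i ⟧ + ⟦ w i ⟧)                 ≡⟨ ∑-distrib-+ (λ i → ⟦ r i ⟧) (λ i → ⟦ w i ⟧) ⟩
  ∑[ i < _ ] ⟦ r i ⟧ + ∑[ i < _ ] ⟦ w i ⟧        ≡⟨ sym (cong₂ _+_ (count≡∑ r) (count≡∑ w)) ⟩
  count r + count w                              ∎
  where open ≡-Reasoning

count-false : ∀ {k} → count {k} (λ _ → false) ≡ 0
count-false {k} = trans (count≡∑ {k} (λ _ → false)) (sum-replicate-zero k)

count-single : ∀ {k} (j : Fin k) → count (λ i → i == j) ≡ 1
count-single j = trans (count≡∑ (λ i → i == j))
  (trans (∑-point _ j (λ i i≢j → cong ⟦_⟧ (≢⇒==-false i≢j))) (cong ⟦_⟧ (==-refl j)))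

count≤ : ∀ {k} (p : Fin k → Bool) → count p ≤ k
count≤ {zero} p = z≤n
count≤ {suc k} p with p zero
... | true = s≤s (count≤ (λ i → p (suc i)))
... | false = m≤n⇒m≤1+n (count≤ (λ i → p (suc i)))

_⊆_ : ∀ {k} → (Fin k → Bool) → (Fin k → Bool) → Set
p ⊆ q = ∀ i → p i ≡ true → q i ≡ true

⊆-antisym : ∀ {k} {p q : Fin k → Bool} → p ⊆ q → q ⊆ p → ∀ i → p i ≡ q i
⊆-antisym {p = p} {q} p⊆q q⊆p i with p i in pi | q i in qi
... | true  | true  = refl
... | false | false = refl
... | true  | false = trans (sym (p⊆q i pi)) qi
... | false | true  = trans (sym pi) (q⊆p i qi)

count-mono : ∀ {k} {p q : Fin k → Bool} → p ⊆ q → count p ≤ count q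
count-mono {zero} p⊆q = z≤n
count-mono {suc k} {p} {q} p⊆q with p zero in p₀ | q zero in q₀
... | true  | true  = s≤s (count-mono (λ i → p⊆q (suc i)))
... | false | true  = m≤n⇒m≤1+n (count-mono (λ i → p⊆q (suc i)))
... | false | false = count-mono (λ i → p⊆q (suc i))
... | true  | false with () ← trans (sym q₀) (p⊆q zero p₀)

count-mono-< : ∀ {k} {p q : Fin k → Bool} → p ⊆ q → (j : Fin k) →
  p j ≡ false → q j ≡ true → count p < count q
count-mono-< {p = p} {q} p⊆q zero pj qj rewrite pj | qj = s≤s (count-mono (λ i → p⊆q (suc i)))
count-mono-< {p = p} {q} p⊆q (suc j) pj qj with p zero in p₀ | q zero in q₀
... | true  | true  = s≤s (count-mono-< (λ i → p⊆q (suc i)) j pj qj)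
... | false | true  = m≤n⇒m≤1+n (count-mono-< (λ i → p⊆q (suc i)) j pj qj)
... | false | false = count-mono-< (λ i → p⊆q (suc i)) j pj qj
... | true  | false with () ← trans (sym q₀) (p⊆q zero p₀)

count-≤⇒⊇ : ∀ {k} {p q : Fin k → Bool} → p ⊆ q → count q ≤ count p → q ⊆ p
count-≤⇒⊇ {p = p} p⊆q q≤p i qi with p i in pi
... | true = refl
... | false = ⊥-elim (<⇒≱ (count-mono-< p⊆q i pi qi) q≤p)

count-positive : ∀ {k} {p : Fin k → Bool} (i : Fin k) → p i ≡ true → 0 < count p
count-positive {k} {p} i pi = subst (_< count p) (count-false {k}) (count-mono-< (λ _ ()) i refl pi)

count≡0⇒false : ∀ {k} {p : Fin k → Bool} → count p ≡ 0 → ∀ i → p i ≡ false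
count≡0⇒false {p = p} count≡0 i with p i in pi
... | false = refl
... | true = ⊥-elim (<⇒≢ (count-positive i pi) (sym count≡0))

count-≤-except : ∀ {k} {p q : Fin k → Bool} (j : Fin k) → (∀ i → i ≢ j → p i ≡ true → q i ≡ true) →
  count p ≤ count q + ⟦ p j ⟧
count-≤-except {p = p} {q} j p⊆q-off-j = begin
  count p                 ≡⟨ sym (+-identityʳ _) ⟩
  count p + ⟦ false ⟧     ≡⟨ cong (λ b → count p + ⟦ b ⟧) (sym p'-at-j) ⟩
  count p + ⟦ p' j ⟧      ≡⟨ count-cong-except p p' j (λ i i≢j → sym (p'-off i≢j)) ⟩
  count p' + ⟦ p j ⟧      ≤⟨ +-monoˡ-≤ _ (count-mono p'⊆q) ⟩
  count q + ⟦ p j ⟧       ∎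
  where
  open ≤-Reasoning
  p' : _ → Bool
  p' i = p i ∧ not (i == j)
  p'-at-j : p' j ≡ false
  p'-at-j rewrite ==-refl j = ∧-zeroʳ (p j)
  p'-off : ∀ {i} → i ≢ j → p' i ≡ p i
  p'-off {i} i≢j rewrite ≢⇒==-false i≢j = ∧-identityʳ (p i)
  p'⊆q : p' ⊆ q
  p'⊆q i p'i = p⊆q-off-j i (==-false⇒≢ (not-injective (∧-conicalʳ _ _ p'i))) (∧-conicalˡ _ _ p'i)

any : ∀ {k} → (Fin k → Bool) → Bool
any {zero} p = false
any {suc k} p = p zero ∨ any (λ i → p (suc i))

any-intro : ∀ {k} (p : Fin k → Bool) (i : Fin k) → p i ≡ true → any p ≡ true
any-intro p zero pi rewrite pi = refl
any-intro p (suc i) pi with p zero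
... | true = refl
... | false = any-intro (λ i → p (suc i)) i pi

any-elim : ∀ {k} (p : Fin k → Bool) → any p ≡ true → ∃ λ i → p i ≡ true
any-elim {suc k} p anyp with p zero in p₀
... | true = zero , p₀
... | false with any-elim (λ i → p (suc i)) anyp
... | i , pi = suc i , pi

any-cong : ∀ {k} {p q : Fin k → Bool} → (∀ i → p i ≡ q i) → any p ≡ any q
any-cong {zero} p≗q = refl
any-cong {suc k} p≗q = cong₂ _∨_ (p≗q zero) (any-cong (λ i → p≗q (suc i)))

toggle : ∀ {k} → (Fin k → Bool) → Fin k → Fin k → Bool
toggle g e i = if i == e then not (g i) else g i

count-toggle : ∀ {k} (g : Fin k → Bool) (e : Fin k) (P : Fin k → Bool) →
  count (λ i → toggle g e i ∧ P i) + ⟦ g e ∧ P e ⟧ ≡ count (λ i → g i ∧ P i) + ⟦ not (g e) ∧ P e ⟧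
count-toggle g e P = begin
  count (λ i → toggle g e i ∧ P i) + ⟦ g e ∧ P e ⟧
    ≡⟨ count-cong-except _ _ e off-e ⟩
  count (λ i → g i ∧ P i) + ⟦ toggle g e e ∧ P e ⟧
    ≡⟨ cong (λ b → count (λ i → g i ∧ P i) + ⟦ b ∧ P e ⟧) at-e ⟩
  count (λ i → g i ∧ P i) + ⟦ not (g e) ∧ P e ⟧ ∎
  where
  open ≡-Reasoning
  at-e : toggle g e e ≡ not (g e)
  at-e rewrite ==-refl e = refl
  off-e : ∀ i → i ≢ e → toggle g e i ∧ P i ≡ g i ∧ P i
  off-e i i≢e rewrite ≢⇒==-false i≢e = refl

-- Flows with supplies and demands

_at_ : ∀ {n} → ℕ → Fin n → Fin n → ℕ
(k at c) z = if c == z then k else 0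

∑-at : ∀ {n} (k : ℕ) (c : Fin n) → ∑[ z < n ] (k at c) z ≡ k
∑-at k c = trans (∑-point (k at c) c (λ z z≢c → cong (if_then k else 0) (≢⇒==-false (≢-sym z≢c))))
                 (cong (if_then k else 0) (==-refl c))

-- At each vertex z the flow g absorbs a z units and injects b z units.
Balanced : ∀ {n} (G : Graph n) → Flow01 G → (Fin n → ℕ) → (Fin n → ℕ) → Set
Balanced G g a b = ∀ z → outflow G g z + a z ≡ inflow G g z + b z

Balanced-shift : ∀ {n} (G : Graph n) (g : Flow01 G) {a b a' b' : Fin n → ℕ} →
  Balanced G g a b → (∀ z → a z + b' z ≡ a' z + b z) → Balanced G g a' b'
Balanced-shift G g {a} {b} {a'} {b'} bal shift z = +-cancelʳ-≡ (b z) _ _ (begin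
  outflow G g z + a' z + b z   ≡⟨ +-assoc (outflow G g z) _ _ ⟩
  outflow G g z + (a' z + b z) ≡⟨ cong (outflow G g z +_) (sym (shift z)) ⟩
  outflow G g z + (a z + b' z) ≡⟨ sym (+-assoc (outflow G g z) _ _) ⟩
  outflow G g z + a z + b' z   ≡⟨ cong (_+ b' z) (bal z) ⟩
  inflow G g z + b z + b' z    ≡⟨ +-assoc (inflow G g z) _ _ ⟩
  inflow G g z + (b z + b' z)  ≡⟨ cong (inflow G g z +_) (+-comm (b z) (b' z)) ⟩
  inflow G g z + (b' z + b z)  ≡⟨ sym (+-assoc (inflow G g z) _ _) ⟩
  inflow G g z + b' z + b z    ∎)
  where open ≡-Reasoning

sumOver : ∀ {n} → VSet n → (Fin n → ℕ) → ℕ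
sumOver {n} S h = ∑[ z < n ] (if S z then h z else 0)

sumOver-+ : ∀ {n} (S : VSet n) (h h' : Fin n → ℕ) →
  sumOver S (λ z → h z + h' z) ≡ sumOver S h + sumOver S h'
sumOver-+ S h h' =
  trans (sum-cong-≗ split) (∑-distrib-+ (λ z → if S z then h z else 0) (λ z → if S z then h' z else 0))
  where
  split : ∀ z → (if S z then h z + h' z else 0) ≡ (if S z then h z else 0) + (if S z then h' z else 0)
  split z with S z
  ... | true = refl
  ... | false = refl

sumOver-at : ∀ {n} (S : VSet n) (k : ℕ) (c : Fin n) → sumOver S (k at c) ≡ (if S c then k else 0)
sumOver-at S k c = trans (∑-point _ c vanish) (cong (λ b → if S c then (if b then k else 0) else 0) (==-refl c))
  where
  vanish : ∀ z → z ≢ c → (if S z then (k at c) z else 0) ≡ 0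
  vanish z z≢c rewrite ≢⇒==-false (≢-sym z≢c) with S z
  ... | true = refl
  ... | false = refl

count-fibres : ∀ {n k} (S : VSet n) (g : Fin k → Bool) (end : Fin k → Fin n) →
  sumOver S (λ z → count (λ e → g e ∧ (end e == z))) ≡ count (λ e → g e ∧ S (end e))
count-fibres {n} {k} S g end = begin
  sumOver S (λ z → count (λ e → g e ∧ (end e == z)))  ≡⟨ sum-cong-≗ count-in-S ⟩
  ∑[ z < n ] ∑[ e < k ] ⟦ S z ∧ (g e ∧ (end e == z)) ⟧ ≡⟨ ∑-comm (λ z e → ⟦ S z ∧ (g e ∧ (end e == z)) ⟧) ⟩
  ∑[ e < k ] ∑[ z < n ] ⟦ S z ∧ (g e ∧ (end e == z)) ⟧ ≡⟨ sum-cong-≗ fibre ⟩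
  ∑[ e < k ] ⟦ g e ∧ S (end e) ⟧                      ≡⟨ sym (count≡∑ (λ e → g e ∧ S (end e))) ⟩
  count (λ e → g e ∧ S (end e))                       ∎
  where
  open ≡-Reasoning
  count-in-S : ∀ z → (if S z then count (λ e → g e ∧ (end e == z)) else 0) ≡
                     ∑[ e < k ] ⟦ S z ∧ (g e ∧ (end e == z)) ⟧
  count-in-S z with S z
  ... | true = count≡∑ (λ e → g e ∧ (end e == z))
  ... | false = sym (sum-replicate-zero k)
  fibre : ∀ e → ∑[ z < n ] ⟦ S z ∧ (g e ∧ (end e == z)) ⟧ ≡ ⟦ g e ∧ S (end e) ⟧
  fibre e = trans (∑-point _ (end e) vanish) (cong ⟦_⟧ at-end)
    where
    vanish : ∀ z → z ≢ end e → ⟦ S z ∧ (g e ∧ (end e == z)) ⟧ ≡ 0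
    vanish z z≢end rewrite ≢⇒==-false (λ end≡z → z≢end (sym end≡z)) | ∧-zeroʳ (g e) | ∧-zeroʳ (S z) = refl
    at-end : S (end e) ∧ (g e ∧ (end e == end e)) ≡ g e ∧ S (end e)
    at-end rewrite ==-refl (end e) | ∧-identityʳ (g e) = ∧-comm (S (end e)) (g e)

flowLeaving flowEntering : ∀ {n} (G : Graph n) → Flow01 G → VSet n → ℕ
flowLeaving G g S = count (λ e → g e ∧ InCut G S e)
flowEntering G g S = count (λ e → g e ∧ (S (hd G e) ∧ not (S (tl G e))))

cut-balance : ∀ {n} (G : Graph n) (g : Flow01 G) {a b : Fin n → ℕ} → Balanced G g a b → (S : VSet n) →
  flowLeaving G g S + sumOver S a ≡ flowEntering G g S + sumOver S b
cut-balance G g {a} {b} bal S = +-cancelˡ-≡ X _ _ (begin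
  X + (L + A)   ≡⟨ solve 3 (λ x l a → x :+ (l :+ a) := l :+ (x :+ a)) refl X L A ⟩
  L + (X + A)   ≡⟨ cong (L +_) tails-in-S ⟩
  L + (Y + B)   ≡⟨ solve 3 (λ l y b → l :+ (y :+ b) := (y :+ l) :+ b) refl L Y B ⟩
  (Y + L) + B   ≡⟨ cong (_+ B) (sym crossing) ⟩
  (X + En) + B  ≡⟨ +-assoc X En B ⟩
  X + (En + B)  ∎)
  where
  open ≡-Reasoning
  X = count (λ e → g e ∧ S (tl G e))
  Y = count (λ e → g e ∧ S (hd G e))
  L = flowLeaving G g S
  En = flowEntering G g S
  A = sumOver S a
  B = sumOver S b
  crossing : X + En ≡ Y + L
  crossing = count-pointwise _ _ _ _ (λ e → edge (g e) (S (tl G e)) (S (hd G e)))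
    where
    edge : ∀ x y w → ⟦ x ∧ y ⟧ + ⟦ x ∧ (w ∧ not y) ⟧ ≡ ⟦ x ∧ w ⟧ + ⟦ x ∧ (y ∧ not w) ⟧
    edge false y w = refl
    edge true true true = refl
    edge true true false = refl
    edge true false true = refl
    edge true false false = refl
  tails-in-S : X + A ≡ Y + B
  tails-in-S = begin
    X + A
      ≡⟨ cong (_+ A) (sym (count-fibres S g (tl G))) ⟩
    sumOver S (outflow G g) + A
      ≡⟨ sym (sumOver-+ S _ a) ⟩
    sumOver S (λ z → outflow G g z + a z)
      ≡⟨ sum-cong-≗ (λ z → cong (if S z then_else 0) (bal z)) ⟩
    sumOver S (λ z → inflow G g z + b z)
      ≡⟨ sumOver-+ S _ b ⟩
    sumOver S (inflow G g) + B
      ≡⟨ cong (_+ B) (count-fibres S g (hd G)) ⟩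
    Y + B ∎

∑-outflow : ∀ {n} (G : Graph n) (g : Flow01 G) → ∑[ z < n ] outflow G g z ≡ count g
∑-outflow G g = trans (count-fibres (λ _ → true) g (tl G)) (count-cong (λ e → ∧-identityʳ (g e)))

∑-inflow : ∀ {n} (G : Graph n) (g : Flow01 G) → ∑[ z < n ] inflow G g z ≡ count g
∑-inflow G g = trans (count-fibres (λ _ → true) g (hd G)) (count-cong (λ e → ∧-identityʳ (g e)))

-- Conservation away from s and t forces it at t as well, since every unit of flow is counted
-- once as outflow and once as inflow.
isFlow⇒balanced : ∀ {n} (G : Graph n) (s t : Fin n) → s ≢ t → (g : Flow01 G) (k : ℕ) →
  IsFlow G s t g k → Balanced G g (k at t) (k at s)
isFlow⇒balanced {n} G s t s≢t g k (conserve , source) z = balanced-at z (z ≟ t)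
  where
  open ≡-Reasoning
  F H : Fin n → ℕ
  F z = outflow G g z + (k at t) z
  H z = inflow G g z + (k at s) z
  off-t : ∀ z → z ≢ t → F z ≡ H z
  off-t z z≢t with s ≟ z
  ... | yes refl rewrite ≢⇒==-false (≢-sym s≢t) = trans (+-identityʳ _) source
  ... | no s≢z rewrite ≢⇒==-false (≢-sym z≢t) = cong (_+ 0) (sym (conserve z (≢-sym s≢z) z≢t))
  ∑F≡∑H : ∑[ z < n ] F z ≡ ∑[ z < n ] H z
  ∑F≡∑H = begin
    ∑[ z < n ] F z                                          ≡⟨ ∑-distrib-+ (outflow G g) (k at t) ⟩
    ∑[ z < n ] outflow G g z + ∑[ z < n ] (k at t) z        ≡⟨ cong₂ _+_ (∑-outflow G g) (∑-at k t) ⟩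
    count g + k                                             ≡⟨ sym (cong₂ _+_ (∑-inflow G g) (∑-at k s)) ⟩
    ∑[ z < n ] inflow G g z + ∑[ z < n ] (k at s) z         ≡⟨ sym (∑-distrib-+ (inflow G g) (k at s)) ⟩
    ∑[ z < n ] H z                                          ∎
  balanced-at : ∀ z → Dec (z ≡ t) → F z ≡ H z
  balanced-at z (no z≢t) = off-t z z≢t
  balanced-at z (yes refl) = sym (+-cancelˡ-≡ (∑[ z < n ] F z) _ _ (begin
    ∑[ z < n ] F z + H t   ≡⟨ ∑-cong-except F H t off-t ⟩
    ∑[ z < n ] H z + F t   ≡⟨ cong (_+ F t) (sym ∑F≡∑H) ⟩
    ∑[ z < n ] F z + F t   ∎))

balanced⇒isFlow : ∀ {n} (G : Graph n) (s t : Fin n) → s ≢ t → (g : Flow01 G) (k : ℕ) →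
  Balanced G g (k at t) (k at s) → IsFlow G s t g k
balanced⇒isFlow G s t s≢t g k bal = conserve , source
  where
  conserve : ∀ v → v ≢ s → v ≢ t → inflow G g v ≡ outflow G g v
  conserve v v≢s v≢t with bal v
  ... | balance rewrite ≢⇒==-false (≢-sym v≢t) | ≢⇒==-false (≢-sym v≢s)
                      | +-identityʳ (outflow G g v) | +-identityʳ (inflow G g v) = sym balance
  source : outflow G g s ≡ inflow G g s + k
  source with bal s
  ... | balance rewrite ≢⇒==-false (≢-sym s≢t) | ==-refl s | +-identityʳ (outflow G g s) = balance

flow-cut-balance : ∀ {n} (G : Graph n) (s t : Fin n) (g : Flow01 G) (k : ℕ) →
  Balanced G g (k at t) (k at s) → (S : VSet n) →
  flowLeaving G g S + (if S t then k else 0) ≡ flowEntering G g S + (if S s then k else 0)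
flow-cut-balance G s t g k bal S = begin
  flowLeaving G g S + (if S t then k else 0)   ≡⟨ cong (flowLeaving G g S +_) (sym (sumOver-at S k t)) ⟩
  flowLeaving G g S + sumOver S (k at t)       ≡⟨ cut-balance G g bal S ⟩
  flowEntering G g S + sumOver S (k at s)      ≡⟨ cong (flowEntering G g S +_) (sumOver-at S k s) ⟩
  flowEntering G g S + (if S s then k else 0)  ∎
  where open ≡-Reasoning

flowLeaving-cut : ∀ {n} (G : Graph n) (s t : Fin n) (g : Flow01 G) (k : ℕ) →
  Balanced G g (k at t) (k at s) → (S : VSet n) → IsCut s t S →
  flowLeaving G g S ≡ flowEntering G g S + k
flowLeaving-cut G s t g k bal S (s∈S , t∉S) with flow-cut-balance G s t g k bal S
... | balance rewrite s∈S | t∉S = trans (sym (+-identityʳ _)) balance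

flowLeaving≤cutCap : ∀ {n} (G : Graph n) (g : Flow01 G) (S : VSet n) → flowLeaving G g S ≤ cutCap G S
flowLeaving≤cutCap G g S = count-mono (λ e → ∧-conicalʳ (g e) _)

weak-duality : ∀ {n} (G : Graph n) (s t : Fin n) → s ≢ t → (g : Flow01 G) (k : ℕ) → IsFlow G s t g k →
  (S : VSet n) → IsCut s t S → k ≤ cutCap G S
weak-duality G s t s≢t g k flow S cut = begin
  k
    ≤⟨ m≤n+m k _ ⟩
  flowEntering G g S + k
    ≡⟨ sym (flowLeaving-cut G s t g k (isFlow⇒balanced G s t s≢t g k flow) S cut) ⟩
  flowLeaving G g S
    ≤⟨ flowLeaving≤cutCap G g S ⟩
  cutCap G S ∎
  where open ≤-Reasoning

-- Residual graphs

src dst : ∀ {n} (G : Graph n) → Flow01 G → Edge G → Fin n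
src G g e = if g e then hd G e else tl G e
dst G g e = if g e then tl G e else hd G e

Balanced-toggle : ∀ {n} (G : Graph n) (g : Flow01 G) {a b : Fin n → ℕ} → Balanced G g a b → (e : Edge G) →
  Balanced G (toggle g e) (λ z → a z + (1 at dst G g e) z) (λ z → b z + (1 at src G g e) z)
Balanced-toggle G g {a} {b} bal e z
  with g e | count-toggle g e (λ i → tl G i == z) | count-toggle g e (λ i → hd G i == z) | bal z
... | true | out | inn | balance =
  cancel-flow {o' = outflow G (toggle g e) z} {i' = inflow G (toggle g e) z}
              {⟦ tl G e == z ⟧} {⟦ hd G e == z ⟧} out inn balance
  where
  cancel-flow : ∀ {o o' i i'} {T H} → o' + T ≡ o + 0 → i' + H ≡ i + 0 → o + a z ≡ i + b z →
    o' + (a z + T) ≡ i' + (b z + H)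
  cancel-flow {o} {o'} {i} {i'} {T} {H} out inn balance = begin
    o' + (a z + T)   ≡⟨ solve 3 (λ x y w → x :+ (y :+ w) := (x :+ w) :+ y) refl o' (a z) T ⟩
    (o' + T) + a z   ≡⟨ cong (_+ a z) (trans out (+-identityʳ o)) ⟩
    o + a z          ≡⟨ balance ⟩
    i + b z          ≡⟨ cong (_+ b z) (sym (trans inn (+-identityʳ i))) ⟩
    (i' + H) + b z   ≡⟨ solve 3 (λ x y w → (x :+ w) :+ y := x :+ (y :+ w)) refl i' (b z) H ⟩
    i' + (b z + H)   ∎
    where open ≡-Reasoning
... | false | out | inn | balance =
  add-flow {o' = outflow G (toggle g e) z} {i' = inflow G (toggle g e) z}
           {⟦ tl G e == z ⟧} {⟦ hd G e == z ⟧} out inn balance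
  where
  add-flow : ∀ {o o' i i'} {T H} → o' + 0 ≡ o + T → i' + 0 ≡ i + H → o + a z ≡ i + b z →
    o' + (a z + H) ≡ i' + (b z + T)
  add-flow {o} {o'} {i} {i'} {T} {H} out inn balance = begin
    o' + (a z + H)
      ≡⟨ cong (_+ (a z + H)) (trans (sym (+-identityʳ o')) out) ⟩
    (o + T) + (a z + H)
      ≡⟨ solve 4 (λ x t y h → (x :+ t) :+ (y :+ h) := (x :+ y) :+ (t :+ h)) refl o T (a z) H ⟩
    (o + a z) + (T + H)
      ≡⟨ cong (_+ (T + H)) balance ⟩
    (i + b z) + (T + H)
      ≡⟨ solve 4 (λ x y t h → (x :+ y) :+ (t :+ h) := (x :+ h) :+ (y :+ t)) refl i (b z) T H ⟩
    (i + H) + (b z + T)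
      ≡⟨ cong (_+ (b z + T)) (trans (sym inn) (+-identityʳ i')) ⟩
    i' + (b z + T) ∎
    where open ≡-Reasoning

Closed : ∀ {n} (G : Graph n) → Flow01 G → (Edge G → Bool) → VSet n → Set
Closed G g d S = ∀ e → d e ≡ false → S (src G g e) ≡ true → S (dst G g e) ≡ true

module Residual {n} (G : Graph n) (g : Flow01 G) (d : Edge G → Bool) where

  data Walk : Fin n → Fin n → Set where
    [] : ∀ {x} → Walk x x
    _∷_ : ∀ {e y} → d e ≡ false → Walk (dst G g e) y → Walk (src G g e) y

  _∷ʳ_ : ∀ {x e} → Walk x (src G g e) → d e ≡ false → Walk x (dst G g e)
  [] ∷ʳ de = de ∷ []
  (de' ∷ W) ∷ʳ de = de' ∷ (W ∷ʳ de)

  Visits : ∀ {x y} → Fin n → Walk x y → Set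
  Visits z ([] {x}) = z ≡ x
  Visits z (_∷_ {e} _ W) = z ≡ src G g e ⊎ Visits z W

  visits? : ∀ {x y} (z : Fin n) (W : Walk x y) → Dec (Visits z W)
  visits? z [] = z ≟ _
  visits? z (_∷_ {e} _ W) = z ≟ src G g e ⊎-dec visits? z W

  Simple : ∀ {x y} → Walk x y → Set
  Simple [] = ⊤
  Simple (_∷_ {e} _ W) = ¬ Visits (src G g e) W × Simple W

  suffixFrom : ∀ {x y} (z : Fin n) (W : Walk x y) → Visits z W → Simple W → Σ (Walk z y) Simple
  suffixFrom z [] refl _ = [] , tt
  suffixFrom z (de ∷ W) (inj₁ refl) simple = de ∷ W , simple
  suffixFrom z (de ∷ W) (inj₂ visits) (_ , simple) = suffixFrom z W visits simple

  simplify : ∀ {x y} → Walk x y → Σ (Walk x y) Simple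
  simplify [] = [] , tt
  simplify (_∷_ {e} de W) with simplify W
  ... | W' , simple with visits? (src G g e) W'
  ... | yes visits = suffixFrom (src G g e) W' visits simple
  ... | no ¬visits = de ∷ W' , ¬visits , simple

  expand : VSet n → VSet n
  expand R z = R z ∨ any (λ e → not (d e) ∧ (R (src G g e) ∧ (dst G g e == z)))

  expand-cong : ∀ {R R' : VSet n} → (∀ z → R z ≡ R' z) → ∀ z → expand R z ≡ expand R' z
  expand-cong R≗R' z = cong₂ _∨_ (R≗R' z)
    (any-cong (λ e → cong (λ b → not (d e) ∧ (b ∧ (dst G g e == z))) (R≗R' (src G g e))))

  reachableWithin : ℕ → Fin n → VSet n
  reachableWithin zero x z = z == x
  reachableWithin (suc k) x = expand (reachableWithin k x)

  reachableWithin⇒Walk : ∀ k {x z} → reachableWithin k x z ≡ true → Walk x z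
  reachableWithin⇒Walk zero z==x = subst (λ z → Walk _ z) (sym (==⇒≡ z==x)) []
  reachableWithin⇒Walk (suc k) {x} {z} reach with reachableWithin k x z in earlier
  ... | true = reachableWithin⇒Walk k earlier
  ... | false with any-elim (λ e → not (d e) ∧ (reachableWithin k x (src G g e) ∧ (dst G g e == z))) reach
  ... | e , edge = subst (Walk x) (==⇒≡ (∧-conicalʳ _ _ rest)) (W ∷ʳ not-injective (∧-conicalˡ _ _ edge))
    where
    rest : reachableWithin k x (src G g e) ∧ (dst G g e == z) ≡ true
    rest = ∧-conicalʳ (not (d e)) _ edge
    W : Walk x (src G g e)
    W = reachableWithin⇒Walk k (∧-conicalˡ _ _ rest)

  Stable : Fin n → ℕ → Set
  Stable x k = ∀ z → reachableWithin (suc k) x z ≡ reachableWithin k x z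

  ⊆-expand : ∀ (R : VSet n) → R ⊆ expand R
  ⊆-expand R z Rz rewrite Rz = refl

  stable-or-growing : ∀ x k → Stable x k ⊎ k < count (reachableWithin k x)
  stable-or-growing x zero = inj₂ (≤-reflexive (sym (count-single x)))
  stable-or-growing x (suc k) with stable-or-growing x k
  ... | inj₁ stable = inj₁ (expand-cong stable)
  ... | inj₂ growing with count (reachableWithin k x) <? count (reachableWithin (suc k) x)
  ... | yes grew = inj₂ (≤-trans (s≤s growing) grew)
  ... | no ¬grew = inj₁ (expand-cong (⊆-antisym (count-≤⇒⊇ (⊆-expand _) (≮⇒≥ ¬grew)) (⊆-expand _)))

  reachable : Fin n → VSet n
  reachable x = reachableWithin n x

  -- Every round before stabilisation adds a vertex, so n rounds suffice.
  reachable-stable : ∀ x → Stable x n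
  reachable-stable x with stable-or-growing x n
  ... | inj₁ stable = stable
  ... | inj₂ growing = ⊥-elim (<⇒≱ growing (count≤ _))

  reachable-start : ∀ x → reachable x x ≡ true
  reachable-start x = within n
    where
    within : ∀ k → reachableWithin k x x ≡ true
    within zero = ==-refl x
    within (suc k) = ⊆-expand (reachableWithin k x) x (within k)

  reachable-closed : ∀ x → Closed G g d (reachable x)
  reachable-closed x e de reach-src = trans (sym (reachable-stable x (dst G g e)))
    (trans (cong (reachable x (dst G g e) ∨_) (any-intro _ e edge)) (∨-zeroʳ _))
    where
    edge : not (d e) ∧ (reachable x (src G g e) ∧ (dst G g e == dst G g e)) ≡ true
    edge rewrite de | reach-src | ==-refl (dst G g e) = refl

  reachable⇒Walk : ∀ {x z} → reachable x z ≡ true → Walk x z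
  reachable⇒Walk = reachableWithin⇒Walk n

  -- Simplicity keeps the first edge untouched while the rest of the walk is augmented.
  augment : ∀ {x y} (W : Walk x y) → Simple W → {a b : Fin n → ℕ} → Balanced G g a b →
    Σ (Flow01 G) λ g' → Balanced G g' (λ z → a z + (1 at y) z) (λ z → b z + (1 at x) z)
                      × (∀ e → ¬ Visits (src G g e) W → g' e ≡ g e)
  augment ([] {x}) _ {a} {b} bal = g , Balanced-shift G g bal shift , λ _ _ → refl
    where
    shift : ∀ z → a z + (b z + (1 at x) z) ≡ (a z + (1 at x) z) + b z
    shift z = solve 3 (λ p q r → p :+ (q :+ r) := (p :+ r) :+ q) refl (a z) (b z) _
  augment (_∷_ {e} {y} de W) (¬visits , simple) {a} {b} bal with augment W simple bal
  ... | g₁ , bal₁ , agrees₁ =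
    toggle g₁ e , Balanced-shift G (toggle g₁ e) (Balanced-toggle G g₁ bal₁ e) shift , agrees
    where
    g₁e : g₁ e ≡ g e
    g₁e = agrees₁ e ¬visits
    shift : ∀ z → (a z + (1 at y) z + (1 at dst G g₁ e) z) + (b z + (1 at src G g e) z)
                ≡ (a z + (1 at y) z) + (b z + (1 at dst G g e) z + (1 at src G g₁ e) z)
    shift z rewrite g₁e =
      solve 5 (λ p q r w v → (p :+ q :+ r) :+ (w :+ v) := (p :+ q) :+ (w :+ r :+ v)) refl (a z) ((1 at y) z) _ (b z) _
    agrees : ∀ e' → ¬ (src G g e' ≡ src G g e ⊎ Visits (src G g e') W) → toggle g₁ e e' ≡ g e'
    agrees e' unvisited rewrite ≢⇒==-false (λ e'≡e → unvisited (inj₁ (cong (src G g) e'≡e))) =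
      agrees₁ e' (λ visits → unvisited (inj₂ visits))

capWithout : ∀ {n} (G : Graph n) → (Edge G → Bool) → VSet n → ℕ
capWithout G d S = count (λ e → not (d e) ∧ InCut G S e)

module _ {n} (G : Graph n) (g : Flow01 G) (d : Edge G → Bool) (S : VSet n) where

  closed-edge : Closed G g d S → ∀ e → d e ≡ false → ∀ {b} → g e ≡ b →
    S (if b then hd G e else tl G e) ≡ true → S (if b then tl G e else hd G e) ≡ true
  closed-edge closed e de refl = closed e de

  closed-intro : (∀ e → d e ≡ false → g e ≡ false → S (tl G e) ≡ true → S (hd G e) ≡ true) →
    (∀ e → d e ≡ false → g e ≡ true → S (hd G e) ≡ true → S (tl G e) ≡ true) → Closed G g d S
  closed-intro forward backward e de with g e in ge
  ... | true = backward e de ge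
  ... | false = forward e de ge

  closed⇒flowEntering≡0 : g ⊆ (λ e → not (d e)) → Closed G g d S → flowEntering G g S ≡ 0
  closed⇒flowEntering≡0 avoids closed = trans (count-cong no-entering) (count-false {length G})
    where
    no-entering : ∀ e → g e ∧ (S (hd G e) ∧ not (S (tl G e))) ≡ false
    no-entering e with g e in ge | S (hd G e) in hd∈S
    ... | false | _ = refl
    ... | true | false = refl
    ... | true | true rewrite closed-edge closed e (not-injective (avoids e ge)) ge hd∈S = refl

  closed⇒capWithout≤flowLeaving : Closed G g d S → capWithout G d S ≤ flowLeaving G g S
  closed⇒capWithout≤flowLeaving closed = count-mono saturated
    where
    saturated : (λ e → not (d e) ∧ InCut G S e) ⊆ (λ e → g e ∧ InCut G S e)
    saturated e crossing with g e in ge | S (tl G e) in tl∈S | S (hd G e) in hd∈S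
    ... | true | _ | _ = ∧-conicalʳ (not (d e)) _ crossing
    ... | false | true | false with () ← trans (sym hd∈S)
          (closed-edge closed e (not-injective (∧-conicalˡ _ _ crossing)) ge tl∈S)
    ... | false | true | true with () ← ∧-conicalʳ (not (d e)) _ crossing
    ... | false | false | _ with () ← ∧-conicalʳ (not (d e)) _ crossing

  flowing⊆usable : g ⊆ (λ e → not (d e)) → (λ e → g e ∧ InCut G S e) ⊆ (λ e → not (d e) ∧ InCut G S e)
  flowing⊆usable avoids e flows = cong₂ _∧_ (avoids e (∧-conicalˡ _ _ flows)) (∧-conicalʳ (g e) _ flows)

  flowLeaving≤capWithout : g ⊆ (λ e → not (d e)) → flowLeaving G g S ≤ capWithout G d S
  flowLeaving≤capWithout avoids = count-mono (flowing⊆usable avoids)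

  -- A cut whose capacity does not exceed the flow value is saturated and receives no flow back.
  tight-cut⇒closed : ∀ s t k → g ⊆ (λ e → not (d e)) → Balanced G g (k at t) (k at s) → IsCut s t S →
    capWithout G d S ≤ k → Closed G g d S
  tight-cut⇒closed s t k avoids bal cut tight = closed-intro forward backward
    where
    leaving : flowLeaving G g S ≡ flowEntering G g S + k
    leaving = flowLeaving-cut G s t g k bal S cut
    no-entering : flowEntering G g S ≡ 0
    no-entering = n≤0⇒n≡0 (+-cancelʳ-≤ k _ 0 (begin
      flowEntering G g S + k   ≡⟨ sym leaving ⟩
      flowLeaving G g S        ≤⟨ flowLeaving≤capWithout avoids ⟩
      capWithout G d S         ≤⟨ tight ⟩
      k                        ∎))
      where open ≤-Reasoning
    saturated : (λ e → not (d e) ∧ InCut G S e) ⊆ (λ e → g e ∧ InCut G S e)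
    saturated = count-≤⇒⊇ (flowing⊆usable avoids)
      (≤-trans tight (≤-trans (m≤n+m k _) (≤-reflexive (sym leaving))))
    crossing : ∀ e → d e ≡ false → S (tl G e) ≡ true → S (hd G e) ≡ false → not (d e) ∧ InCut G S e ≡ true
    crossing e de tl∈S hd∈S rewrite de | tl∈S | hd∈S = refl
    entering : ∀ e → g e ≡ true → S (hd G e) ≡ true → S (tl G e) ≡ false →
      g e ∧ (S (hd G e) ∧ not (S (tl G e))) ≡ true
    entering e ge hd∈S tl∈S rewrite ge | hd∈S | tl∈S = refl
    forward : ∀ e → d e ≡ false → g e ≡ false → S (tl G e) ≡ true → S (hd G e) ≡ true
    forward e de ge tl∈S with S (hd G e) in hd∈S
    ... | true = refl
    ... | false with () ← trans (sym ge) (∧-conicalˡ _ _ (saturated e (crossing e de tl∈S hd∈S)))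
    backward : ∀ e → d e ≡ false → g e ≡ true → S (hd G e) ≡ true → S (tl G e) ≡ true
    backward e de ge hd∈S with S (tl G e) in tl∈S
    ... | true = refl
    ... | false with () ← trans (sym (entering e ge hd∈S tl∈S)) (count≡0⇒false no-entering e)

  closed-flowLeaving : ∀ s t k → g ⊆ (λ e → not (d e)) → Closed G g d S → Balanced G g (k at t) (k at s) →
    flowLeaving G g S + (if S t then k else 0) ≡ (if S s then k else 0)
  closed-flowLeaving s t k avoids closed bal =
    trans (flow-cut-balance G s t g k bal S)
          (cong (_+ (if S s then k else 0)) (closed⇒flowEntering≡0 avoids closed))

-- Max-flow min-cut

record MaxFlowMinCut {n} (G : Graph n) (s t : Fin n) : Set where
  field
    flow : Flow01 G
    value : ℕ
    isFlow : IsFlow G s t flow value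
    cut : VSet n
    isCut : IsCut s t cut
    cutCap≡value : cutCap G cut ≡ value

0-at : ∀ {n} (c z : Fin n) → (0 at c) z ≡ 0
0-at c z with c == z
... | true = refl
... | false = refl

at-suc : ∀ {n} (k : ℕ) (c z : Fin n) → (k at c) z + (1 at c) z ≡ (suc k at c) z
at-suc k c z with c == z
... | true = +-comm k 1
... | false = refl

module FordFulkerson {n} (G : Graph n) (s t : Fin n) (s≢t : s ≢ t) where

  open Residual G using (reachable; reachable-start; reachable-closed; reachable⇒Walk; simplify; augment)

  noneDeleted : Edge G → Bool
  noneDeleted _ = false

  value≤edges : ∀ {g k} → Balanced G g (k at t) (k at s) → k ≤ length G
  value≤edges {g} {k} bal = begin
    k                        ≤⟨ m≤n+m k _ ⟩
    inflow G g s + k         ≡⟨ sym (proj₂ (balanced⇒isFlow G s t s≢t g k bal)) ⟩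
    outflow G g s            ≤⟨ count≤ _ ⟩
    length G                 ∎
    where open ≤-Reasoning

  -- Without an augmenting path, the vertices reachable from s in G_g form a cut of capacity k.
  finish : ∀ g k → Balanced G g (k at t) (k at s) → reachable g noneDeleted s t ≡ false →
    MaxFlowMinCut G s t
  finish g k bal t-unreached = record
    { flow = g ; value = k ; isFlow = balanced⇒isFlow G s t s≢t g k bal
    ; cut = S ; isCut = s∈S , t-unreached
    ; cutCap≡value = ≤-antisym
        (≤-trans (closed⇒capWithout≤flowLeaving G g noneDeleted S closed) (≤-reflexive leaving))
        (≤-trans (≤-reflexive (sym leaving)) (flowLeaving≤cutCap G g S)) }
    where
    S = reachable g noneDeleted s
    s∈S = reachable-start g noneDeleted s
    closed = reachable-closed g noneDeleted s
    leaving : flowLeaving G g S ≡ k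
    leaving = begin
      flowLeaving G g S
        ≡⟨ sym (+-identityʳ _) ⟩
      flowLeaving G g S + 0
        ≡⟨ cong (λ b → flowLeaving G g S + (if b then k else 0)) (sym t-unreached) ⟩
      flowLeaving G g S + (if S t then k else 0)
        ≡⟨ closed-flowLeaving G g noneDeleted S s t k (λ _ _ → refl) closed bal ⟩
      (if S s then k else 0)
        ≡⟨ cong (if_then k else 0) s∈S ⟩
      k ∎
      where open ≡-Reasoning

  -- Each round raises the value by one, and the value never exceeds the number of edges.
  augmentFrom : (rounds : ℕ) → ∀ g k → Balanced G g (k at t) (k at s) → length G < k + rounds →
    MaxFlowMinCut G s t
  augmentFrom rounds g k bal bound with reachable g noneDeleted s t in t-reached
  ... | false = finish g k bal t-reached
  augmentFrom zero g k bal bound | true =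
    ⊥-elim (<⇒≱ (≤-trans bound (≤-reflexive (+-identityʳ k))) (value≤edges bal))
  augmentFrom (suc rounds) g k bal bound | true
    with simplify g noneDeleted (reachable⇒Walk g noneDeleted t-reached)
  ... | W , simple with augment g noneDeleted W simple bal
  ... | g' , bal' , _ = augmentFrom rounds g' (suc k)
          (Balanced-shift G g' bal' (λ z → cong₂ _+_ (at-suc k t z) (sym (at-suc k s z))))
          (≤-trans bound (≤-reflexive (+-suc k rounds)))

  maxFlowMinCut : MaxFlowMinCut G s t
  maxFlowMinCut = augmentFrom (suc (length G)) (λ _ → false) 0 zero-flow ≤-refl
    where
    zero-flow : Balanced G (λ _ → false) (0 at t) (0 at s)
    zero-flow z = cong (count {length G} (λ _ → false) +_) (trans (0-at t z) (sym (0-at s z)))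

-- Deleting e₁ and e₂

cutCap-deleteEdges : ∀ {n} (G : Graph n) (d : Edge G → Bool) (S : VSet n) →
  cutCap (deleteEdges G d) S ≡ capWithout G d S
cutCap-deleteEdges [] d S = refl
cutCap-deleteEdges (_ ∷ G) d S with d zero
... | true = cutCap-deleteEdges G (λ i → d (suc i)) S
... | false = cong (_ +_) (cutCap-deleteEdges G (λ i → d (suc i)) S)

∈-residualMinus : ∀ {n} (G : Graph n) (g : Flow01 G) (d : Edge G → Bool) (e : Edge G) → d e ≡ false →
  (src G g e , dst G g e) ∈ residualMinus G g d
∈-residualMinus (_ ∷ G) g d zero de rewrite de with g zero
... | true = here refl
... | false = here refl
∈-residualMinus (_ ∷ G) g d (suc e) de with d zero
... | true = ∈-residualMinus G (λ i → g (suc i)) (λ i → d (suc i)) e de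
... | false = there (∈-residualMinus G (λ i → g (suc i)) (λ i → d (suc i)) e de)

residualMinus-∈ : ∀ {n} (G : Graph n) (g : Flow01 G) (d : Edge G → Bool) {x y : Fin n} →
  (x , y) ∈ residualMinus G g d → ∃ λ e → d e ≡ false × src G g e ≡ x × dst G g e ≡ y
residualMinus-∈ ((a , b) ∷ G) g d x,y∈ with d zero in d₀
residualMinus-∈ ((a , b) ∷ G) g d x,y∈rest | true
  with residualMinus-∈ G (λ i → g (suc i)) (λ i → d (suc i)) x,y∈rest
... | e , found = suc e , found
residualMinus-∈ ((a , b) ∷ G) g d (there x,y∈rest) | false
  with residualMinus-∈ G (λ i → g (suc i)) (λ i → d (suc i)) x,y∈rest
... | e , found = suc e , found
residualMinus-∈ ((a , b) ∷ G) g d (here x,y≡) | false = zero , d₀ , endpoints (g zero) x,y≡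
  where
  endpoints : ∀ {x y} c → (x , y) ≡ (if c then (b , a) else (a , b)) →
    (if c then b else a) ≡ x × (if c then a else b) ≡ y
  endpoints true refl = refl , refl
  endpoints false refl = refl , refl

Walk⇒Reach : ∀ {n} (G : Graph n) (g : Flow01 G) (d : Edge G → Bool) {x y : Fin n} →
  Residual.Walk G g d x y → Reach (residualMinus G g d) x y
Walk⇒Reach G g d Residual.[] = here
Walk⇒Reach G g d (Residual._∷_ {e} de W) = step (∈-residualMinus G g d e de) (Walk⇒Reach G g d W)

closed-Reach : ∀ {n} (G : Graph n) (g : Flow01 G) (d : Edge G → Bool) (S : VSet n) → Closed G g d S →
  ∀ {x y} → Reach (residualMinus G g d) x y → S x ≡ true → S y ≡ true
closed-Reach G g d S closed here x∈S = x∈S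
closed-Reach G g d S closed (step x,w∈ w↝y) x∈S with residualMinus-∈ G g d x,w∈
... | e , de , refl , refl = closed-Reach G g d S closed w↝y (closed e de x∈S)

InCut-endpoints : ∀ {n} (G : Graph n) (S : VSet n) (e : Edge G) → InCut G S e ≡ true →
  S (tl G e) ≡ true × S (hd G e) ≡ false
InCut-endpoints G S e crosses = ∧-conicalˡ _ _ crosses , not-injective (∧-conicalʳ _ _ crosses)

⟦⟧≤1 : ∀ b → ⟦ b ⟧ ≤ 1
⟦⟧≤1 true = ≤-refl
⟦⟧≤1 false = z≤n

-- A set that flow leaves but never enters contains s and not t, and carries the full value.
positive-outflow⇒cut : ∀ {L k} (s∈S t∈S : Bool) → 0 < L →
  L + (if t∈S then k else 0) ≡ (if s∈S then k else 0) → s∈S ≡ true × t∈S ≡ false × L ≡ k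
positive-outflow⇒cut {suc L} false t∈S _ ()
positive-outflow⇒cut {suc L} {k} true true _ balance with () ← +-cancelʳ-≡ k (suc L) 0 balance
positive-outflow⇒cut {suc L} true false _ balance = refl , refl , trans (sym (+-identityʳ _)) balance

module RemovingTwoEdges {n} (G : Graph n) (s t : Fin n) (s≢t : s ≢ t) (lam : ℕ) (f : Flow01 G)
  (f-flow : IsFlow G s t f lam) (e₁ e₂ : Edge G) (f₁ : f e₁ ≡ false) (f₂ : f e₂ ≡ true) where

  without₁ without₁₂ : Edge G → Bool
  without₁ e = e == e₁
  without₁₂ e = (e == e₁) ∨ (e == e₂)

  H R : Graph n
  H = deleteEdges G without₁₂
  R = residualMinus G f without₁

  u v : Fin n
  u = tl G e₂
  v = hd G e₂

  balanced : Balanced G f (lam at t) (lam at s)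
  balanced = isFlow⇒balanced G s t s≢t f lam f-flow

  flow-avoids-e₁ : f ⊆ (λ e → not (without₁ e))
  flow-avoids-e₁ e fe = cong not (≢⇒==-false (λ e≡e₁ → true≢false (trans (sym fe) (trans (cong f e≡e₁) f₁))))

  e₂≢e₁ : e₂ ≢ e₁
  e₂≢e₁ = ==-false⇒≢ (not-injective (flow-avoids-e₁ e₂ f₂))

  lam≤capWithout₁ : ∀ S → IsCut s t S → lam ≤ capWithout G without₁ S
  lam≤capWithout₁ S cut = begin
    lam                               ≤⟨ m≤n+m lam _ ⟩
    flowEntering G f S + lam          ≡⟨ sym (flowLeaving-cut G s t f lam balanced S cut) ⟩
    flowLeaving G f S                 ≤⟨ flowLeaving≤capWithout G f without₁ S flow-avoids-e₁ ⟩
    capWithout G without₁ S           ∎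
    where open ≤-Reasoning

  capWithout₁≤cutCap+e₂ : ∀ S → capWithout G without₁ S ≤ cutCap H S + ⟦ InCut G S e₂ ⟧
  capWithout₁≤cutCap+e₂ S = begin
    capWithout G without₁ S
      ≤⟨ count-≤-except e₂ off-e₂ ⟩
    capWithout G without₁₂ S + ⟦ not (e₂ == e₁) ∧ InCut G S e₂ ⟧
                                                   ≡⟨ cong₂ (λ c b → c + ⟦ not b ∧ InCut G S e₂ ⟧)
                                                        (sym (cutCap-deleteEdges G without₁₂ S)) (≢⇒==-false e₂≢e₁) ⟩
    cutCap H S + ⟦ InCut G S e₂ ⟧ ∎
    where
    open ≤-Reasoning
    off-e₂ : ∀ e → e ≢ e₂ → not (e == e₁) ∧ InCut G S e ≡ true → not (without₁₂ e) ∧ InCut G S e ≡ true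
    off-e₂ e e≢e₂ usable rewrite ≢⇒==-false e≢e₂ | ∨-identityʳ (e == e₁) = usable

  cutCap<capWithout₁ : ∀ S → InCut G S e₂ ≡ true → cutCap H S < capWithout G without₁ S
  cutCap<capWithout₁ S crosses = begin-strict
    cutCap H S                 ≡⟨ cutCap-deleteEdges G without₁₂ S ⟩
    capWithout G without₁₂ S   <⟨ count-mono-< fewer e₂ e₂-deleted e₂-usable ⟩
    capWithout G without₁ S    ∎
    where
    open ≤-Reasoning
    fewer : (λ e → not (without₁₂ e) ∧ InCut G S e) ⊆ (λ e → not (without₁ e) ∧ InCut G S e)
    fewer e usable with e == e₁ | usable
    ... | false | usable-off-e₁ = ∧-conicalʳ (not (e == e₂)) _ usable-off-e₁
    ... | true | ()
    e₂-deleted : not (without₁₂ e₂) ∧ InCut G S e₂ ≡ false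
    e₂-deleted rewrite ==-refl e₂ | ∨-zeroʳ (e₂ == e₁) = refl
    e₂-usable : not (without₁ e₂) ∧ InCut G S e₂ ≡ true
    e₂-usable rewrite ≢⇒==-false e₂≢e₁ = crosses

  reach-v-u : Reach R v u
  reach-v-u = step (subst₂ (λ x y → (x , y) ∈ R) (cong (if_then v else u) f₂) (cong (if_then u else v) f₂)
                      (∈-residualMinus G f without₁ e₂ (≢⇒==-false e₂≢e₁)))
                   here

  MaxFlowDrops : Set
  MaxFlowDrops = ∃ λ μ → suc μ ≡ lam × IsMaxFlowValue H s t μ

  flowCutH : MaxFlowMinCut H s t
  flowCutH = FordFulkerson.maxFlowMinCut H s t s≢t

  open MaxFlowMinCut flowCutH

  lam≤value+e₂ : lam ≤ value + ⟦ InCut G cut e₂ ⟧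
  lam≤value+e₂ = begin
    lam                                   ≤⟨ lam≤capWithout₁ cut isCut ⟩
    capWithout G without₁ cut             ≤⟨ capWithout₁≤cutCap+e₂ cut ⟩
    cutCap H cut + ⟦ InCut G cut e₂ ⟧     ≡⟨ cong (_+ ⟦ InCut G cut e₂ ⟧) cutCap≡value ⟩
    value + ⟦ InCut G cut e₂ ⟧            ∎
    where open ≤-Reasoning

  -- The vertices reachable from u in R form a cut of H of capacity below lam.
  ¬connected⇒drops : ¬ StronglyConnected R u v → MaxFlowDrops
  ¬connected⇒drops ¬connected = value , suc-value≡lam , (flow , isFlow) , below-S
    where
    open Residual G f without₁ using (reachable; reachable-start; reachable-closed; reachable⇒Walk)
    S = reachable u
    closed = reachable-closed u
    v∉S : S v ≡ false
    v∉S with S v in v∈S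
    ... | false = refl
    ... | true = ⊥-elim (¬connected (Walk⇒Reach G f without₁ (reachable⇒Walk v∈S) , reach-v-u))
    e₂-crosses : InCut G S e₂ ≡ true
    e₂-crosses rewrite reachable-start u | v∉S = refl
    leaving-positive : 0 < flowLeaving G f S
    leaving-positive = count-positive e₂ (cong₂ _∧_ f₂ e₂-crosses)
    cut-S = positive-outflow⇒cut (S s) (S t) leaving-positive
              (closed-flowLeaving G f without₁ S s t lam flow-avoids-e₁ closed balanced)
    cutCap<lam : cutCap H S < lam
    cutCap<lam = begin-strict
      cutCap H S                 <⟨ cutCap<capWithout₁ S e₂-crosses ⟩
      capWithout G without₁ S    ≤⟨ closed⇒capWithout≤flowLeaving G f without₁ S closed ⟩
      flowLeaving G f S          ≡⟨ proj₂ (proj₂ cut-S) ⟩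
      lam                        ∎
      where open ≤-Reasoning
    weak : ∀ h j → IsFlow H s t h j → j ≤ cutCap H S
    weak h j h-flow = weak-duality H s t s≢t h j h-flow S (proj₁ cut-S , proj₁ (proj₂ cut-S))
    suc-value≡lam : suc value ≡ lam
    suc-value≡lam = ≤-antisym (<-≤-trans (s≤s (weak flow value isFlow)) cutCap<lam)
      (≤-trans lam≤value+e₂ (≤-trans (+-monoʳ-≤ value (⟦⟧≤1 _)) (≤-reflexive (+-comm value 1))))
    below-S : ∀ h j → IsFlow H s t h j → j ≤ value
    below-S h j h-flow =
      ≤-pred (≤-trans (s≤s (weak h j h-flow)) (≤-trans cutCap<lam (≤-reflexive (sym suc-value≡lam))))

  -- A minimum cut of H of capacity lam - 1 must be crossed by e₂ and is closed in R.
  drops⇒¬connected : MaxFlowDrops → ¬ StronglyConnected R u v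
  drops⇒¬connected (μ , suc-μ≡lam , _ , maximal) (u↝v , _) =
    true≢false (trans (sym (closed-Reach G f without₁ cut closed u↝v u∈cut)) v∉cut)
    where
    value≤μ : value ≤ μ
    value≤μ = maximal flow value isFlow
    e₂-crosses : InCut G cut e₂ ≡ true
    e₂-crosses with InCut G cut e₂ in crossing
    ... | true = refl
    ... | false = ⊥-elim (<⇒≱ (≤-reflexive suc-μ≡lam)
                  (≤-trans (subst (λ b → lam ≤ value + ⟦ b ⟧) crossing lam≤value+e₂)
                           (≤-trans (≤-reflexive (+-identityʳ value)) value≤μ)))
    u∈cut = proj₁ (InCut-endpoints G cut e₂ e₂-crosses)
    v∉cut = proj₂ (InCut-endpoints G cut e₂ e₂-crosses)
    tight : capWithout G without₁ cut ≤ lam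
    tight = begin
      capWithout G without₁ cut           ≤⟨ capWithout₁≤cutCap+e₂ cut ⟩
      cutCap H cut + ⟦ InCut G cut e₂ ⟧   ≡⟨ cong₂ (λ c b → c + ⟦ b ⟧) cutCap≡value e₂-crosses ⟩
      value + 1                           ≤⟨ +-monoˡ-≤ 1 value≤μ ⟩
      μ + 1                               ≡⟨ trans (+-comm μ 1) suc-μ≡lam ⟩
      lam                                 ∎
      where open ≤-Reasoning
    closed = tight-cut⇒closed G f without₁ cut s t lam flow-avoids-e₁ balanced isCut tight

lemma6 : ∀ {n} (G : Graph n) (s t : Fin n) → s ≢ t →
    (lam : ℕ) → IsMaxFlowValue G s t lam →
    (A : Fin (suc lam) → Flow01 G) →
    (∀ j → IsFlow G s t (A j) lam) →
    (∀ e → ¬ Critical G s t e → ∃ λ j → A j e ≡ false) →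
    (e₁ e₂ : Edge G) (j : Fin (suc lam)) →
    A j e₁ ≡ false → A j e₂ ≡ true →
    (∃ λ μ → (suc μ ≡ lam)
       × IsMaxFlowValue (deleteEdges G (λ e → (e == e₁) ∨ (e == e₂))) s t μ)
    ⇔ (¬ StronglyConnected (residualMinus G (A j) (λ e → e == e₁))
           (tl G e₂) (hd G e₂))
lemma6 G s t s≢t lam _ A flows _ e₁ e₂ j f₁ f₂ = mk⇔ drops⇒¬connected ¬connected⇒drops
  where open RemovingTwoEdges G s t s≢t lam (A j) (flows j) e₁ e₂ f₁ f₂
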